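{- For any $(\lambda, \mu) \sqsupseteq (\lambda'', \mu'')$ in $S_{\pi}$, we can find integers $b < c$ such that \[ (\lambda, \mu) \sqsupset (\lambda \,\mathrm{zig}_{bc}\, \mu,\ \lambda \,\mathrm{zag}_{bc}\, \mu) \sqsupseteq (\lambda'', \mu'').\] Moreover, we can take $(b,c)$ to be of the form either $(\delta_p, \delta_{p}+1)$ or $(\delta_p, \delta_q)$ for some indices $p,q$, where $\delta = \mu - \lambda$.
   Context: For $x,y\in\mathbb{Z}^n$, let $\Pi(x,y) = \{ z \in \mathbb{Z}^n : \min(x_i-x_j, y_i - y_j) \leq z_i - z_j \leq \max(x_i - x_j, y_i - y_j) \text{ for all } 1 \leq i < j \leq n \}$. Fix $\pi\in\mathbb{Z}^n$ and let $S_{\pi}$ be the set of ordered pairs of vectors $(\lambda, \mu)\in(\mathbb{Z}^n)^2$ (not necessarily dominant) with $\lambda+\mu = \pi$. Define the preorder $(\lambda', \mu') \sqsubseteq (\lambda, \mu)$ (also written $(\lambda,\mu)\sqsupseteq(\lambda',\mu')$) if $\Pi(\lambda', \mu') \subseteq \Pi(\lambda, \mu)$; write $\sim$ for the associated equivalence relation (both $\sqsubseteq$ and $\sqsupseteq$ hold), and $(\lambda', \mu') \sqsubset (\lambda, \mu)$ if $(\lambda', \mu') \sqsubseteq (\lambda, \mu)$ and $(\lambda, \mu) \not\sim (\lambda', \mu')$. For integers $b<c$ and integers $x,y$, define the "zig" and "zag" operations $x \,\mathrm{zig}_{bc}\, y = x+b$ if $y \leq x+b$, $= y$ if $x+b \leq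 y \leq x+c$, $= x+c$ if $x+c \leq y$; and $x \,\mathrm{zag}_{bc}\, y = y-b$ if $y \leq x+b$, $= x$ if $x+b \leq y \leq x+c$, $= y-c$ if $x+c \leq y$. For $\lambda,\mu\in\mathbb{Z}^n$, $\lambda \,\mathrm{zig}_{bc}\, \mu$ and $\lambda \,\mathrm{zag}_{bc}\, \mu$ are defined coordinatewise; note they sum to $\lambda+\mu$, so the pair lies in $S_\pi$. -}

module Defs where

open import Data.Nat using (ℕ)
open import Data.Fin using (Fin; toℕ)
import Data.Nat as ℕ
open import Data.Integer using (ℤ; _+_; _-_; _≤_; _<_; _⊓_; _⊔_; _≤?_)
open import Data.Product using (_×_; _,_)
open import Relation.Nullary using (¬_; yes; no)
open import Relation.Binary.PropositionalEquality using (_≡_)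

Vecℤ : ℕ → Set
Vecℤ n = Fin n → ℤ

_+ᵛ_ : ∀ {n} → Vecℤ n → Vecℤ n → Vecℤ n
(x +ᵛ y) i = x i + y i

_-ᵛ_ : ∀ {n} → Vecℤ n → Vecℤ n → Vecℤ n
(x -ᵛ y) i = x i - y i

_∈Π[_,_] : ∀ {n} → Vecℤ n → Vecℤ n → Vecℤ n → Set
_∈Π[_,_] {n} z x y = (i j : Fin n) → toℕ i ℕ.< toℕ j →
  ((x i - x j) ⊓ (y i - y j) ≤ z i - z j) × (z i - z j ≤ (x i - x j) ⊔ (y i - y j))

Pair : ℕ → Set
Pair n = Vecℤ n × Vecℤ n

InS : ∀ {n} → Vecℤ n → Pair n → Set
InS π (l , m) = ∀ i → l i + m i ≡ π i

_⊑_ : ∀ {n} → Pair n → Pair n → Set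
_⊑_ {n} (l' , m') (l , m) = (z : Vecℤ n) → z ∈Π[ l' , m' ] → z ∈Π[ l , m ]

_∼_ : ∀ {n} → Pair n → Pair n → Set
P ∼ Q = (P ⊑ Q) × (Q ⊑ P)

_⊏_ : ∀ {n} → Pair n → Pair n → Set
P ⊏ Q = (P ⊑ Q) × ¬ (Q ∼ P)

-- scalar zig / zag with parameters b c (intended b < c)
zigℤ : ℤ → ℤ → ℤ → ℤ → ℤ
zigℤ b c x y with y ≤? x + b
... | yes _ = x + b
... | no _ with y ≤? x + c
...   | yes _ = y
...   | no _ = x + c

zagℤ : ℤ → ℤ → ℤ → ℤ → ℤ
zagℤ b c x y with y ≤? x + b
... | yes _ = y - b
... | no _ with y ≤? x + c
...   | yes _ = x
...   | no _ = y - c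

zig : ∀ {n} → ℤ → ℤ → Vecℤ n → Vecℤ n → Vecℤ n
zig b c x y i = zigℤ b c (x i) (y i)

zag : ∀ {n} → ℤ → ℤ → Vecℤ n → Vecℤ n → Vecℤ n
zag b c x y i = zagℤ b c (x i) (y i)

-- Translating by λ, a pair of S_π becomes (λ + u, λ + v) with u + v = δ := μ − λ, and it is ⊑ (λ, μ)
-- exactly when u and v both increase along δ; zig_bc and zag_bc become the clamp g = min(max(δ, b), c)
-- and δ − g. Write (λ'', μ'') = (λ + f, λ + e) and call a pair of indices mixed when f and e both
-- increase strictly across it. Without mixed pairs (λ, μ) ⊑ (λ'', μ''), so a mixed pair exists. If two
-- consecutive values of δ form a mixed pair, the window [δ_p, δ_p + 1] works. Otherwise every step
-- between consecutive values of δ leaves f or e constant, and we clamp to a shortest maximal run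
-- [δ_b, δ_c] on which f (say) is constant: the neighbouring runs, on which e is constant, are at least
-- as long, and that is what puts λ'' and μ'' in Π(zig, zag).
module Submission where

open import Defs
open import Data.Nat using (ℕ; s≤s; z≤n)
import Data.Nat.Properties as ℕ
open import Data.Fin using (Fin; toℕ)
open import Data.Fin.Properties using (toℕ-injective; any?; all?)
open import Data.Integer using (ℤ; _+_; _-_; -_; _≤_; _<_; _⊓_; _⊔_; _≤?_; _<?_; 0ℤ; 1ℤ; +<+)
open import Data.Integer.Properties
open import Data.Integer.Tactic.RingSolver using (solve-∀)
open import Data.Empty using (⊥-elim)
open import Data.List using (List; filter; allFin; cartesianProduct)
open import Data.List.Membership.Propositional using (_∈_)
open import Data.List.Membership.Propositional.Properties using (∈-filter⁺; ∈-allFin; ∈-cartesianProduct⁺)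
open import Data.List.Relation.Unary.All using (lookup)
open import Data.List.Relation.Unary.All.Properties using (all-filter)
import Data.List.Extrema as Extrema
open import Data.Product using (_×_; _,_; proj₁; proj₂; uncurry; ∃-syntax; Σ-syntax)
import Data.Product as Product
open import Data.Sum using (_⊎_; inj₁; inj₂)
import Data.Sum as Sum
open import Function using (case_of_)
open import Relation.Binary using (tri<; tri≈; tri>)
open import Relation.Binary.PropositionalEquality
  using (_≡_; refl; sym; trans; cong; cong₂; subst; subst₂; module ≡-Reasoning)
open import Relation.Nullary using (¬_; Dec; yes; no)
open import Relation.Nullary.Decidable using (_×-dec_; _⊎-dec_; _→-dec_)
open import Relation.Unary using (Decidable)

private
  variable
    n : ℕ
    i j k l : Fin n
    o u v w x y z x′ y′ : Vecℤ n

module _ {A : Set} (xs : List A) (complete : ∀ a → a ∈ xs)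
         {P : A → Set} (P? : Decidable P) (key : A → ℤ) where
  open Extrema ≤-totalOrder

  minimiser : ∀ {a₀} → P a₀ → Σ[ a ∈ A ] P a × (∀ a′ → P a′ → key a ≤ key a′)
  minimiser {a₀} pa₀ =
    argmin key a₀ (filter P? xs) ,
    argmin-all key pa₀ (all-filter P? xs) ,
    λ a′ pa′ → lookup (f[argmin]≤f[xs] a₀ (filter P? xs)) (∈-filter⁺ P? (complete a′) pa′)

  maximiser : ∀ {a₀} → P a₀ → Σ[ a ∈ A ] P a × (∀ a′ → P a′ → key a′ ≤ key a)
  maximiser {a₀} pa₀ =
    argmax key a₀ (filter P? xs) ,
    argmax-all key pa₀ (all-filter P? xs) ,
    λ a′ pa′ → lookup (f[xs]≤f[argmax] a₀ (filter P? xs)) (∈-filter⁺ P? (complete a′) pa′)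

allPairs : ∀ n → List (Fin n × Fin n)
allPairs n = cartesianProduct (allFin n) (allFin n)

∈-allPairs : (ij : Fin n × Fin n) → ij ∈ allPairs n
∈-allPairs (i , j) = ∈-cartesianProduct⁺ (∈-allFin i) (∈-allFin j)

i≤i+j⁺ : ∀ {i j} → 0ℤ ≤ j → i ≤ i + j
i≤i+j⁺ {i} {j} 0≤j = subst (_≤ i + j) (+-identityʳ i) (+-monoʳ-≤ i 0≤j)

i≤j+i⁺ : ∀ {i j} → 0ℤ ≤ j → i ≤ j + i
i≤j+i⁺ {i} {j} 0≤j = subst (_≤ j + i) (+-identityˡ i) (+-monoˡ-≤ i 0≤j)

i+j≤i⁻ : ∀ {i j} → j ≤ 0ℤ → i + j ≤ i
i+j≤i⁻ {i} {j} j≤0 = subst (i + j ≤_) (+-identityʳ i) (+-monoʳ-≤ i j≤0)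

j+i≤i⁻ : ∀ {i j} → j ≤ 0ℤ → j + i ≤ i
j+i≤i⁻ {i} {j} j≤0 = subst (j + i ≤_) (+-identityˡ i) (+-monoˡ-≤ i j≤0)

i≤i+j⇒0≤j : ∀ {i j} → i ≤ i + j → 0ℤ ≤ j
i≤i+j⇒0≤j {i} {j} i≤i+j = subst (0ℤ ≤_) (solve i j) (i≤j⇒0≤j-i i≤i+j)
  where solve : ∀ i j → (i + j) - i ≡ j
        solve = solve-∀

i<j⇒0<j-i : ∀ {i j} → i < j → 0ℤ < j - i
i<j⇒0<j-i {i} {j} i<j = subst (_< j - i) (+-inverseʳ i) (+-monoˡ-< (- i) i<j)

0<j-i⇒i<j : ∀ {i j} → 0ℤ < j - i → i < j
0<j-i⇒i<j {i} {j} 0<j-i = subst₂ _<_ (+-identityˡ i) (solve i j) (+-monoˡ-< i 0<j-i)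
  where solve : ∀ i j → (j - i) + i ≡ j
        solve = solve-∀

Between : ℤ → ℤ → ℤ → Set
Between t a b = a ⊓ b ≤ t × t ≤ a ⊔ b

between-≤ : ∀ {t a b} → a ≤ t → t ≤ b → Between t a b
between-≤ {t} {a} {b} a≤t t≤b = ≤-trans (i⊓j≤i a b) a≤t , ≤-trans t≤b (i≤j⊔i a b)

between-≥ : ∀ {t a b} → b ≤ t → t ≤ a → Between t a b
between-≥ {t} {a} {b} b≤t t≤a = ≤-trans (i⊓j≤j a b) b≤t , ≤-trans t≤a (i≤i⊔j a b)

between-cases : ∀ {t a b} → Between t a b → (a ≤ t × t ≤ b) ⊎ (b ≤ t × t ≤ a)
between-cases {t} {a} {b} (lower , upper) with ≤-total a b
... | inj₁ a≤b = inj₁ (subst (_≤ t) (i≤j⇒i⊓j≡i a≤b) lower , subst (t ≤_) (i≤j⇒i⊔j≡j a≤b) upper)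
... | inj₂ b≤a = inj₂ (subst (_≤ t) (i≥j⇒i⊓j≡j b≤a) lower , subst (t ≤_) (i≥j⇒i⊔j≡i b≤a) upper)

between-cong : ∀ {t a b t′ a′ b′} → t ≡ t′ → a ≡ a′ → b ≡ b′ → Between t a b → Between t′ a′ b′
between-cong refl refl refl between = between

between-hull : ∀ {r s t a b} → Between r a b → Between s a b → Between t r s → Between t a b
between-hull (r-lower , r-upper) (s-lower , s-upper) (t-lower , t-upper) =
  ≤-trans (⊓-glb r-lower s-lower) t-lower , ≤-trans t-upper (⊔-lub r-upper s-upper)

between-+ : ∀ {t a b} s → Between t a b → Between (s + t) (s + a) (s + b)
between-+ {t} {a} {b} s (lower , upper) =
  subst (_≤ s + t) (mono-≤-distrib-⊓ (+-monoʳ-≤ s) a b) (+-monoʳ-≤ s lower) ,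
  subst (s + t ≤_) (mono-≤-distrib-⊔ (+-monoʳ-≤ s) a b) (+-monoʳ-≤ s upper)

between-neg : ∀ {t a b} → Between t a b → Between (- t) (- a) (- b)
between-neg {t} {a} {b} (lower , upper) =
  subst (_≤ - t) (neg-distrib-⊔-⊓ a b) (neg-mono-≤ upper) ,
  subst (- t ≤_) (neg-distrib-⊓-⊔ a b) (neg-mono-≤ lower)

¬between-0 : ∀ {a b} → 0ℤ < a → 0ℤ < b → ¬ Between 0ℤ a b
¬between-0 0<a 0<b between with between-cases between
... | inj₁ (a≤0 , _) = <⇒≱ 0<a a≤0
... | inj₂ (b≤0 , _) = <⇒≱ 0<b b≤0

Δ : Vecℤ n → Fin n → Fin n → ℤ
Δ u i j = u j - u i

0ᵛ : Vecℤ n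
0ᵛ _ = 0ℤ

-- These two relations are records, not function types, so that unification can recover the vectors.
record PairwiseBetween (u v w : Vecℤ n) : Set where
  constructor pairwise
  field between : ∀ i j → Between (Δ u i j) (Δ v i j) (Δ w i j)
open PairwiseBetween public

record _≗_⊕_ (z o u : Vecℤ n) : Set where
  constructor pointwise
  field at : ∀ i → z i ≡ o i + u i

Δ-flip : (u : Vecℤ n) (i j : Fin n) → - Δ u j i ≡ Δ u i j
Δ-flip u i j = solve (u i) (u j)
  where solve : ∀ a b → - (a - b) ≡ b - a
        solve = solve-∀

between-flip : (u v w : Vecℤ n) →
  Between (Δ u j i) (Δ v j i) (Δ w j i) → Between (Δ u i j) (Δ v i j) (Δ w i j)
between-flip {j = j} {i = i} u v w between =
  between-cong (Δ-flip u i j) (Δ-flip v i j) (Δ-flip w i j) (between-neg between)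

pairwise-along : (key : Vecℤ n) →
  (∀ i j → key i ≤ key j → Between (Δ u i j) (Δ v i j) (Δ w i j)) → PairwiseBetween u v w
pairwise-along {u = u} {v = v} {w = w} key ordered = pairwise any-order
  where
  any-order : ∀ i j → Between (Δ u i j) (Δ v i j) (Δ w i j)
  any-order i j with ≤-total (key i) (key j)
  ... | inj₁ i≤j = ordered i j i≤j
  ... | inj₂ j≤i = between-flip u v w (ordered j i j≤i)

∈Π⇒pairwise : z ∈Π[ x , y ] → PairwiseBetween z x y
∈Π⇒pairwise {z = z} {x = x} {y = y} z∈Π = pairwise any-order
  where
  any-order : ∀ i j → Between (Δ z i j) (Δ x i j) (Δ y i j)
  any-order i j with ℕ.<-cmp (toℕ i) (toℕ j)
  ... | tri< i<j _ _ = between-flip z x y (z∈Π i j i<j)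
  ... | tri> _ _ j<i = z∈Π j i j<i
  ... | tri≈ _ i≡j _ rewrite toℕ-injective i≡j =
    between-cong (sym (+-inverseʳ (z j))) (sym (+-inverseʳ (x j))) (sym (+-inverseʳ (y j)))
      (between-≤ ≤-refl ≤-refl)

pairwise⇒∈Π : PairwiseBetween z x y → z ∈Π[ x , y ]
pairwise⇒∈Π z∈Π i j _ = between z∈Π j i

Δ-⊕ : z ≗ o ⊕ u → Δ z i j ≡ Δ o i j + Δ u i j
Δ-⊕ {z = z} {o = o} {u = u} {i = i} {j = j} (pointwise z≡o+u) = begin
  z j - z i                   ≡⟨ cong₂ _-_ (z≡o+u j) (z≡o+u i) ⟩
  (o j + u j) - (o i + u i)   ≡⟨ solve (o i) (o j) (u i) (u j) ⟩
  (o j - o i) + (u j - u i)   ∎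
  where
  open ≡-Reasoning
  solve : ∀ oi oj ui uj → (oj + uj) - (oi + ui) ≡ (oj - oi) + (uj - ui)
  solve = solve-∀

⊕-transpose : z ≗ o ⊕ u → u ≗ (λ k → - o k) ⊕ z
⊕-transpose {z = z} {o = o} {u = u} (pointwise z≡o+u) = pointwise λ k → begin
  u k                 ≡⟨ solve (o k) (u k) ⟩
  - o k + (o k + u k) ≡⟨ cong (- o k +_) (sym (z≡o+u k)) ⟩
  - o k + z k         ∎
  where
  open ≡-Reasoning
  solve : ∀ a b → b ≡ - a + (a + b)
  solve = solve-∀

⊕-identityʳ : u ≗ u ⊕ 0ᵛ
⊕-identityʳ {u = u} = pointwise λ i → sym (+-identityʳ (u i))

⊕-difference : v ≗ u ⊕ (v -ᵛ u)
⊕-difference {v = v} {u = u} = pointwise λ i → solve (u i) (v i)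
  where solve : ∀ a b → b ≡ a + (b - a)
        solve = solve-∀

Δ-subᵛ : (u v : Vecℤ n) (i j : Fin n) → Δ (u -ᵛ v) i j ≡ Δ u i j - Δ v i j
Δ-subᵛ u v i j = solve (u i) (u j) (v i) (v j)
  where solve : ∀ ui uj vi vj → (uj - vj) - (ui - vi) ≡ (uj - ui) - (vj - vi)
        solve = solve-∀

pairwise-translate : z ≗ o ⊕ u → x ≗ o ⊕ v → y ≗ o ⊕ w →
  PairwiseBetween u v w → PairwiseBetween z x y
pairwise-translate {o = o} z≗ x≗ y≗ u∈Π = pairwise λ i j →
  between-cong (sym (Δ-⊕ z≗)) (sym (Δ-⊕ x≗)) (sym (Δ-⊕ y≗)) (between-+ (Δ o i j) (between u∈Π i j))

pairwise-untranslate : z ≗ o ⊕ u → x ≗ o ⊕ v → y ≗ o ⊕ w →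
  PairwiseBetween z x y → PairwiseBetween u v w
pairwise-untranslate z≗ x≗ y≗ = pairwise-translate (⊕-transpose z≗) (⊕-transpose x≗) (⊕-transpose y≗)

∈Π-left : x ∈Π[ x , y ]
∈Π-left {x = x} {y = y} i j _ = i⊓j≤i (x i - x j) (y i - y j) , i≤i⊔j (x i - x j) (y i - y j)

⊑-intro : x′ ∈Π[ x , y ] → y′ ∈Π[ x , y ] → (x′ , y′) ⊑ (x , y)
⊑-intro x′∈Π y′∈Π z z∈Π i j i<j = between-hull (x′∈Π i j i<j) (y′∈Π i j i<j) (z∈Π i j i<j)

⊑-translate : x′ ≗ o ⊕ u → y′ ≗ o ⊕ v → x ≗ o ⊕ w → y ≗ o ⊕ z →
  PairwiseBetween u w z → PairwiseBetween v w z → (x′ , y′) ⊑ (x , y)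
⊑-translate {x′ = x′} {y′ = y′} {x = x} {y = y} x′≗ y′≗ x≗ y≗ u∈Π v∈Π =
  ⊑-intro {x′ = x′} {x = x} {y = y} {y′ = y′}
    (pairwise⇒∈Π (pairwise-translate x′≗ x≗ y≗ u∈Π)) (pairwise⇒∈Π (pairwise-translate y′≗ x≗ y≗ v∈Π))

-- Monotone decompositions

Monotone : (d u : Vecℤ n) → Set
Monotone d u = ∀ i j → d i ≤ d j → 0ℤ ≤ Δ u i j

Δ-telescope : (u : Vecℤ n) (i k j : Fin n) → Δ u i j ≡ Δ u i k + Δ u k j
Δ-telescope u i k j = solve (u i) (u k) (u j)
  where solve : ∀ a b c → c - a ≡ (b - a) + (c - b)
        solve = solve-∀

Δ-inner : ∀ {d u : Vecℤ n} → Monotone d u →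
  d i ≤ d k → d k ≤ d l → d l ≤ d j → Δ u k l ≤ Δ u i j
Δ-inner {i = i} {k = k} {l = l} {j = j} {u = u} mono i≤k k≤l l≤j = begin
  Δ u k l               ≤⟨ i≤i+j⁺ (mono l j l≤j) ⟩
  Δ u k l + Δ u l j     ≡⟨ Δ-telescope u k l j ⟨
  Δ u k j               ≤⟨ i≤j+i⁺ (mono i k i≤k) ⟩
  Δ u i k + Δ u k j     ≡⟨ Δ-telescope u i k j ⟨
  Δ u i j               ∎
  where open ≤-Reasoning

Δ-drop-left : (u : Vecℤ n) → Δ u i k ≤ 0ℤ → Δ u i j ≤ Δ u k j
Δ-drop-left {i = i} {k = k} {j = j} u ik≤0 =
  subst (_≤ Δ u k j) (sym (Δ-telescope u i k j)) (j+i≤i⁻ ik≤0)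

Δ-drop-right : (u : Vecℤ n) → Δ u k j ≤ 0ℤ → Δ u i j ≤ Δ u i k
Δ-drop-right {k = k} {j = j} {i = i} u kj≤0 =
  subst (_≤ Δ u i k) (sym (Δ-telescope u i k j)) (i+j≤i⁻ kj≤0)

Δ-<-left : (u : Vecℤ n) → u k < u i → Δ u i j < Δ u k j
Δ-<-left {j = j} u k<i = +-monoʳ-< (u j) (neg-mono-< k<i)

Δ-<-right : (u : Vecℤ n) → u j < u k → Δ u i j < Δ u i k
Δ-<-right {i = i} u j<k = +-monoˡ-< (- u i) j<k

Δ-const : (u : Vecℤ n) → u i ≡ u j → Δ u i j ≡ 0ℤ
Δ-const {i = i} u ui≡uj = trans (cong (_- u i) (sym ui≡uj)) (+-inverseʳ (u i))

record MonotoneSum (d u v : Vecℤ n) : Set where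
  field
    sum   : d ≗ u ⊕ v
    mono₁ : Monotone d u
    mono₂ : Monotone d v

monotoneSum-swap : ∀ {d : Vecℤ n} → MonotoneSum d u v → MonotoneSum d v u
monotoneSum-swap {u = u} {v = v} split = record
  { sum = pointwise λ i → trans (_≗_⊕_.at sum i) (+-comm (u i) (v i)) ; mono₁ = mono₂ ; mono₂ = mono₁ }
  where open MonotoneSum split

monotoneSum⇒pairwise : ∀ {d : Vecℤ n} → MonotoneSum d u v → PairwiseBetween u 0ᵛ d
monotoneSum⇒pairwise {u = u} {v = v} {d = d} split = pairwise-along d λ i j i≤j →
  between-≤ (mono₁ i j i≤j) (subst (Δ u i j ≤_) (sym (Δ-⊕ sum)) (i≤i+j⁺ (mono₂ i j i≤j)))
  where open MonotoneSum split

pairwise⇒monotoneSum : ∀ {d : Vecℤ n} → d ≗ u ⊕ v → PairwiseBetween u 0ᵛ d → MonotoneSum d u v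
pairwise⇒monotoneSum {u = u} {v = v} {d = d} d≗u⊕v u∈Π = record
  { sum = d≗u⊕v
  ; mono₁ = λ i j i≤j → proj₁ (bounds i j i≤j)
  ; mono₂ = λ i j i≤j → i≤i+j⇒0≤j (subst (Δ u i j ≤_) (Δ-⊕ d≗u⊕v) (proj₂ (bounds i j i≤j))) }
  where
  bounds : ∀ i j → d i ≤ d j → 0ℤ ≤ Δ u i j × Δ u i j ≤ Δ d i j
  bounds i j i≤j with between-cases (between u∈Π i j)
  ... | inj₁ within = within
  ... | inj₂ (D≤U , U≤0) = ≤-trans (i≤j⇒0≤j-i i≤j) D≤U , ≤-trans U≤0 (i≤j⇒0≤j-i i≤j)

-- Clamping and the zig/zag operations

clamp : ℤ → ℤ → ℤ → ℤ
clamp lo hi t = lo ⊔ (t ⊓ hi)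

clamp-below : ∀ {lo hi t} → t ≤ lo → clamp lo hi t ≡ lo
clamp-below {lo} {hi} {t} t≤lo = i≥j⇒i⊔j≡i (≤-trans (i⊓j≤i t hi) t≤lo)

clamp-inside : ∀ {lo hi t} → lo ≤ t → t ≤ hi → clamp lo hi t ≡ t
clamp-inside {lo} lo≤t t≤hi = trans (cong (lo ⊔_) (i≤j⇒i⊓j≡i t≤hi)) (i≤j⇒i⊔j≡j lo≤t)

clamp-above : ∀ {lo hi t} → lo ≤ hi → hi ≤ t → clamp lo hi t ≡ hi
clamp-above {lo} lo≤hi hi≤t = trans (cong (lo ⊔_) (i≥j⇒i⊓j≡j hi≤t)) (i≤j⇒i⊔j≡j lo≤hi)

clamp-mono : ∀ {lo hi s t} → s ≤ t → clamp lo hi s ≤ clamp lo hi t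
clamp-mono {lo} {hi} s≤t = ⊔-monoʳ-≤ lo (⊓-monoˡ-≤ hi s≤t)

clamp-+ : ∀ lo hi t r → clamp lo hi t + r ≡ clamp (lo + r) (hi + r) (t + r)
clamp-+ lo hi t r = begin
  (lo ⊔ (t ⊓ hi)) + r              ≡⟨ mono-≤-distrib-⊔ (+-monoˡ-≤ r) lo (t ⊓ hi) ⟩
  (lo + r) ⊔ ((t ⊓ hi) + r)        ≡⟨ cong ((lo + r) ⊔_) (mono-≤-distrib-⊓ (+-monoˡ-≤ r) t hi) ⟩
  (lo + r) ⊔ ((t + r) ⊓ (hi + r))  ∎
  where open ≡-Reasoning

clamp-1-lipschitz : ∀ {lo hi s t} → s ≤ t → clamp lo hi t ≤ clamp lo hi s + (t - s)
clamp-1-lipschitz {lo} {hi} {s} {t} s≤t = begin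
  clamp lo hi t                      ≤⟨ ⊔-mono-≤ (i≤i+j⁺ 0≤r) (⊓-monoʳ-≤ t (i≤i+j⁺ 0≤r)) ⟩
  clamp (lo + r) (hi + r) t          ≡⟨ cong (clamp (lo + r) (hi + r)) (solve s t) ⟩
  clamp (lo + r) (hi + r) (s + r)    ≡⟨ clamp-+ lo hi s r ⟨
  clamp lo hi s + r                  ∎
  where
  open ≤-Reasoning
  r : ℤ
  r = t - s
  0≤r : 0ℤ ≤ r
  0≤r = i≤j⇒0≤j-i s≤t
  solve : ∀ s t → t ≡ s + (t - s)
  solve = solve-∀

clampᵛ : ℤ → ℤ → Vecℤ n → Vecℤ n
clampᵛ lo hi d i = clamp lo hi (d i)

clamp-monotoneSum : ∀ {d : Vecℤ n} {lo hi : ℤ} → MonotoneSum d (clampᵛ lo hi d) (d -ᵛ clampᵛ lo hi d)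
clamp-monotoneSum {n} {d} {lo} {hi} = record
  { sum = pointwise λ i → solve (d i) (g i)
  ; mono₁ = λ i j i≤j → i≤j⇒0≤j-i (clamp-mono {lo} {hi} i≤j)
  ; mono₂ = λ i j i≤j → subst (0ℤ ≤_) (solve′ (d i) (d j) (g i) (g j))
                                (i≤j⇒0≤j-i (clamp-1-lipschitz {lo} {hi} i≤j)) }
  where
  g : Vecℤ n
  g = clampᵛ lo hi d
  solve : ∀ a b → a ≡ b + (a - b)
  solve = solve-∀
  solve′ : ∀ a b ga gb → (ga + (b - a)) - gb ≡ (b - gb) - (a - ga)
  solve′ = solve-∀

private
  s+r-s≡r : ∀ s r → (s + r) - s ≡ r
  s+r-s≡r = solve-∀

  clamp-diff-below : ∀ {b c s t} → t ≤ s + b → clamp b c (t - s) ≡ b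
  clamp-diff-below {b} {s = s} {t} t≤s+b = clamp-below (subst (t - s ≤_) (s+r-s≡r s b) (+-monoˡ-≤ (- s) t≤s+b))

  clamp-diff-inside : ∀ {b c s t} → ¬ t ≤ s + b → t ≤ s + c → clamp b c (t - s) ≡ t - s
  clamp-diff-inside {b} {c} {s} {t} t≰s+b t≤s+c = clamp-inside
    (subst (_≤ t - s) (s+r-s≡r s b) (+-monoˡ-≤ (- s) (<⇒≤ (≰⇒> t≰s+b))))
    (subst (t - s ≤_) (s+r-s≡r s c) (+-monoˡ-≤ (- s) t≤s+c))

  clamp-diff-above : ∀ {b c s t} → b ≤ c → ¬ t ≤ s + c → clamp b c (t - s) ≡ c
  clamp-diff-above {c = c} {s} {t} b≤c t≰s+c =
    clamp-above b≤c (subst (_≤ t - s) (s+r-s≡r s c) (+-monoˡ-≤ (- s) (<⇒≤ (≰⇒> t≰s+c))))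

zig-clamp : ∀ {b c} s t → b ≤ c → zigℤ b c s t ≡ s + clamp b c (t - s)
zig-clamp {b} {c} s t b≤c with t ≤? s + b
... | yes t≤s+b = cong (s +_) (sym (clamp-diff-below t≤s+b))
... | no t≰s+b with t ≤? s + c
...   | yes t≤s+c = trans (solve s t) (cong (s +_) (sym (clamp-diff-inside t≰s+b t≤s+c)))
  where solve : ∀ s t → t ≡ s + (t - s)
        solve = solve-∀
...   | no t≰s+c = cong (s +_) (sym (clamp-diff-above b≤c t≰s+c))

zag-clamp : ∀ {b c} s t → b ≤ c → zagℤ b c s t ≡ t - clamp b c (t - s)
zag-clamp {b} {c} s t b≤c with t ≤? s + b
... | yes t≤s+b = cong (_-_ t) (sym (clamp-diff-below t≤s+b))
... | no t≰s+b with t ≤? s + c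
...   | yes t≤s+c = trans (solve s t) (cong (_-_ t) (sym (clamp-diff-inside t≰s+b t≤s+c)))
  where solve : ∀ s t → s ≡ t - (t - s)
        solve = solve-∀
...   | no t≰s+c = cong (_-_ t) (sym (clamp-diff-above b≤c t≰s+c))

-- Windows

SameSide : ℤ → ℤ → ℤ → Set
SameSide t a b = (t ≤ a × t ≤ b) ⊎ (a ≤ t × b ≤ t)

sameSide-swap : ∀ {t a b} → SameSide t a b → SameSide t b a
sameSide-swap (inj₁ (t≤a , t≤b)) = inj₁ (t≤b , t≤a)
sameSide-swap (inj₂ (a≤t , b≤t)) = inj₂ (b≤t , a≤t)

sameSide-crossing : ∀ {t a b} → t ≤ b → (a < t → b ≤ t) → SameSide t a b
sameSide-crossing {t} {a} t≤b a<t⇒b≤t with t ≤? a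
... | yes t≤a = inj₁ (t≤a , t≤b)
... | no t≰a  = inj₂ (<⇒≤ (≰⇒> t≰a) , a<t⇒b≤t (≰⇒> t≰a))

sameSide⇒between : ∀ {t a b s} → SameSide t a b → a + b ≡ s → Between a t (s - t)
sameSide⇒between {t} {a} {b} (inj₁ (t≤a , t≤b)) refl =
  between-≤ t≤a (subst (a ≤_) (sym (+-assoc a b (- t))) (i≤i+j⁺ (i≤j⇒0≤j-i t≤b)))
sameSide⇒between {t} {a} {b} (inj₂ (a≤t , b≤t)) refl =
  between-≥ (subst (_≤ a) (sym (+-assoc a b (- t))) (i+j≤i⁻ (i≤j⇒i-j≤0 b≤t))) a≤t

StrictCut : ℤ → ℤ → Vecℤ n → Set
StrictCut lo hi d = ∃[ i ] ∃[ j ] 0ℤ < Δ (clampᵛ lo hi d) i j × Δ (clampᵛ lo hi d) i j < Δ d i j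

record Window (d f e : Vecℤ n) : Set where
  field
    B C   : ℤ
    B<C   : B < C
    shape : (∃[ p ] (B ≡ d p × C ≡ d p + 1ℤ)) ⊎ (∃[ p ] ∃[ q ] (B ≡ d p × C ≡ d q))
    fits  : ∀ i j → d i ≤ d j → SameSide (Δ (clampᵛ B C d) i j) (Δ f i j) (Δ e i j)
    cuts  : StrictCut B C d

window-swap : ∀ {d f e : Vecℤ n} → Window d e f → Window d f e
window-swap W = record
  { B = B ; C = C ; B<C = B<C ; shape = shape ; cuts = cuts
  ; fits = λ i j i≤j → sameSide-swap (fits i j i≤j) }
  where open Window W

module ZigZag {n} (l m : Vecℤ n) {B C : ℤ} (B≤C : B ≤ C) where

  d g h : Vecℤ n
  d = m -ᵛ l
  g = clampᵛ B C d
  h = d -ᵛ g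

  zig≗ : zig B C l m ≗ l ⊕ g
  zig≗ = pointwise λ i → zig-clamp (l i) (m i) B≤C

  zag≗ : zag B C l m ≗ l ⊕ h
  zag≗ = pointwise λ i → trans (zag-clamp (l i) (m i) B≤C) (solve (l i) (m i) (g i))
    where solve : ∀ s t r → t - r ≡ s + ((t - s) - r)
          solve = solve-∀

  zigzag-⊑ : (zig B C l m , zag B C l m) ⊑ (l , m)
  zigzag-⊑ = ⊑-translate zig≗ zag≗ (⊕-identityʳ {u = l}) (⊕-difference {v = m} {u = l})
    (monotoneSum⇒pairwise clamp-monotoneSum) (monotoneSum⇒pairwise (monotoneSum-swap clamp-monotoneSum))

  ¬⊑-zigzag : StrictCut B C d → ¬ (l , m) ⊑ (zig B C l m , zag B C l m)
  ¬⊑-zigzag (i , j , 0<G , G<D) l,m⊑ = ¬between-0 0<G 0<H (between l∈Π i j)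
    where
    l∈Π : PairwiseBetween 0ᵛ g h
    l∈Π = pairwise-untranslate (⊕-identityʳ {u = l}) zig≗ zag≗
            (∈Π⇒pairwise (l,m⊑ l (∈Π-left {x = l} {y = m})))
    0<H : 0ℤ < Δ h i j
    0<H = subst (0ℤ <_) (sym (Δ-subᵛ d g i j)) (i<j⇒0<j-i G<D)

  ⊑-zigzag : ∀ {l'' m'' f e : Vecℤ n} → l'' ≗ l ⊕ f → m'' ≗ l ⊕ e → d ≗ f ⊕ e →
    (∀ i j → d i ≤ d j → SameSide (Δ g i j) (Δ f i j) (Δ e i j)) →
    (l'' , m'') ⊑ (zig B C l m , zag B C l m)
  ⊑-zigzag {f = f} {e = e} l''≗ m''≗ d≗f⊕e fits = ⊑-translate l''≗ m''≗ zig≗ zag≗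
    (pairwise-along d λ i j i≤j → toward-h (sameSide⇒between (fits i j i≤j) (sym (Δ-⊕ d≗f⊕e))))
    (pairwise-along d λ i j i≤j → toward-h (sameSide⇒between (sameSide-swap (fits i j i≤j))
                                              (trans (+-comm (Δ e i j) (Δ f i j)) (sym (Δ-⊕ d≗f⊕e)))))
    where
    toward-h : ∀ {i j t} → Between t (Δ g i j) (Δ d i j - Δ g i j) → Between t (Δ g i j) (Δ h i j)
    toward-h {i} {j} = between-cong refl refl (sym (Δ-subᵛ d g i j))

-- Runs of flat steps

Consecutive : Vecℤ n → Fin n → Fin n → Set
Consecutive d i j = d i < d j × (∀ k → d i < d k → d j ≤ d k)

consecutive? : (d : Vecℤ n) → ∀ i j → Dec (Consecutive d i j)
consecutive? d i j = (d i <? d j) ×-dec all? (λ k → (d i <? d k) →-dec (d j ≤? d k))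

predecessor : ∀ {d : Vecℤ n} → d i < d j → ∃[ k ] Consecutive d k j
predecessor {j = j} {d = d} i<j with maximiser (allFin _) ∈-allFin (λ k → d k <? d j) d i<j
... | k , k<j , greatest = k , k<j , λ l k<l → ≮⇒≥ λ l<j → <⇒≱ k<l (greatest l l<j)

successor : ∀ {d : Vecℤ n} → d i < d j → ∃[ k ] Consecutive d i k
successor {i = i} {d = d} i<j with minimiser (allFin _) ∈-allFin (λ k → d i <? d k) d i<j
... | k , i<k , least = k , i<k , least

Mixed : (f e : Vecℤ n) → Fin n → Fin n → Set
Mixed f e i j = 0ℤ < Δ f i j × 0ℤ < Δ e i j

mixed? : (f e : Vecℤ n) → ∀ i j → Dec (Mixed f e i j)
mixed? f e i j = (0ℤ <? Δ f i j) ×-dec (0ℤ <? Δ e i j)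

Flat : (d f e : Vecℤ n) → Fin n → Fin n → Set
Flat d f e i j = d i < d j × (Δ f i j ≤ 0ℤ ⊎ Δ e i j ≤ 0ℤ)

flat? : (d f e : Vecℤ n) → ∀ i j → Dec (Flat d f e i j)
flat? d f e i j = (d i <? d j) ×-dec ((Δ f i j ≤? 0ℤ) ⊎-dec (Δ e i j ≤? 0ℤ))

MaximalFlat : (d f e : Vecℤ n) → Fin n → Fin n → Set
MaximalFlat d f e b c =
  Flat d f e b c × (∀ k → d k < d b → Mixed f e k c) × (∀ k → d c < d k → Mixed f e b k)

maximalFlat? : (d f e : Vecℤ n) → ∀ b c → Dec (MaximalFlat d f e b c)
maximalFlat? d f e b c = flat? d f e b c
  ×-dec all? (λ k → (d k <? d b) →-dec mixed? f e k c)
  ×-dec all? (λ k → (d c <? d k) →-dec mixed? f e b k)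

ShortestMaximalFlat : (d f e : Vecℤ n) → Fin n → Fin n → Set
ShortestMaximalFlat d f e b c =
  MaximalFlat d f e b c × (∀ b′ c′ → MaximalFlat d f e b′ c′ → Δ d b c ≤ Δ d b′ c′)

NoConsecutiveMixed : (d f e : Vecℤ n) → Set
NoConsecutiveMixed d f e = ∀ i j → Consecutive d i j → ¬ Mixed f e i j

maximalFlat-swap : ∀ {d f e : Vecℤ n} {b c} → MaximalFlat d f e b c → MaximalFlat d e f b c
maximalFlat-swap ((b<c , flat) , left , right) =
  (b<c , Sum.swap flat) , (λ k k<b → Product.swap (left k k<b)) , (λ k c<k → Product.swap (right k c<k))

shortest-swap : ∀ {d f e : Vecℤ n} {b c} → ShortestMaximalFlat d f e b c → ShortestMaximalFlat d e f b c
shortest-swap {d = d} {f} {e} (maximal , shortest) =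
  maximalFlat-swap {f = f} {e} maximal ,
  λ b′ c′ maximal′ → shortest b′ c′ (maximalFlat-swap {f = e} {f} maximal′)

data Position (lo hi x : ℤ) : Set where
  below  : x < lo → Position lo hi x
  inside : lo ≤ x → x ≤ hi → Position lo hi x
  above  : hi < x → Position lo hi x

position : ∀ lo hi x → Position lo hi x
position lo hi x with x <? lo | hi <? x
... | yes x<lo | _        = below x<lo
... | no _     | yes hi<x = above hi<x
... | no x≮lo  | no hi≮x  = inside (≮⇒≥ x≮lo) (≮⇒≥ hi≮x)

strictCut-left : ∀ {d : Vecℤ n} {i b c} → d i < d b → d b < d c → StrictCut (d b) (d c) d
strictCut-left {d = d} {i} {b} {c} i<b b<c = i , c , 0<G , G<D
  where
  G≡ : Δ (clampᵛ (d b) (d c) d) i c ≡ Δ d b c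
  G≡ = cong₂ _-_ (clamp-above (<⇒≤ b<c) ≤-refl) (clamp-below (<⇒≤ i<b))
  0<G : 0ℤ < Δ (clampᵛ (d b) (d c) d) i c
  0<G = subst (0ℤ <_) (sym G≡) (i<j⇒0<j-i b<c)
  G<D : Δ (clampᵛ (d b) (d c) d) i c < Δ d i c
  G<D = subst (_< Δ d i c) (sym G≡) (Δ-<-left d i<b)

strictCut-right : ∀ {d : Vecℤ n} {b c j} → d b < d c → d c < d j → StrictCut (d b) (d c) d
strictCut-right {d = d} {b} {c} {j} b<c c<j = b , j , 0<G , G<D
  where
  G≡ : Δ (clampᵛ (d b) (d c) d) b j ≡ Δ d b c
  G≡ = cong₂ _-_ (clamp-above (<⇒≤ b<c) (<⇒≤ c<j)) (clamp-below ≤-refl)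
  0<G : 0ℤ < Δ (clampᵛ (d b) (d c) d) b j
  0<G = subst (0ℤ <_) (sym G≡) (i<j⇒0<j-i b<c)
  G<D : Δ (clampᵛ (d b) (d c) d) b j < Δ d b j
  G<D = subst (_< Δ d b j) (sym G≡) (Δ-<-right d c<j)

module _ {d f e : Vecℤ n} (split : MonotoneSum d f e) where
  open MonotoneSum split renaming (mono₁ to f-mono; mono₂ to e-mono)

  private
    F E D : Fin n → Fin n → ℤ
    F = Δ f
    E = Δ e
    D = Δ d

    d-mono : Monotone d d
    d-mono i j = i≤j⇒0≤j-i

    D≡F+E : ∀ i j → D i j ≡ F i j + E i j
    D≡F+E i j = Δ-⊕ sum

    F≤D : d i ≤ d j → F i j ≤ D i j
    F≤D {i} {j} i≤j = subst (F i j ≤_) (sym (D≡F+E i j)) (i≤i+j⁺ (e-mono i j i≤j))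

    E≤D : d i ≤ d j → E i j ≤ D i j
    E≤D {i} {j} i≤j = subst (E i j ≤_) (sym (D≡F+E i j)) (i≤j+i⁺ (f-mono i j i≤j))

    D≤E : F i j ≤ 0ℤ → D i j ≤ E i j
    D≤E {i} {j} F≤0 = subst (_≤ E i j) (sym (D≡F+E i j)) (j+i≤i⁻ F≤0)

    D≤F : E i j ≤ 0ℤ → D i j ≤ F i j
    D≤F {i} {j} E≤0 = subst (_≤ F i j) (sym (D≡F+E i j)) (i+j≤i⁻ E≤0)

    F-inner : d i ≤ d k → d k ≤ d l → d l ≤ d j → F k l ≤ F i j
    F-inner = Δ-inner {u = f} f-mono

    E-inner : d i ≤ d k → d k ≤ d l → d l ≤ d j → E k l ≤ E i j
    E-inner = Δ-inner {u = e} e-mono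

    D-inner : d i ≤ d k → d k ≤ d l → d l ≤ d j → D k l ≤ D i j
    D-inner = Δ-inner {u = d} d-mono

    mixed-or-flat : d i < d j → Mixed f e i j ⊎ Flat d f e i j
    mixed-or-flat {i} {j} i<j with 0ℤ <? F i j | 0ℤ <? E i j
    ... | yes 0<F | yes 0<E = inj₁ (0<F , 0<E)
    ... | no 0≮F  | _       = inj₂ (i<j , inj₁ (≮⇒≥ 0≮F))
    ... | yes _   | no 0≮E  = inj₂ (i<j , inj₂ (≮⇒≥ 0≮E))

    flat-of-consecutive : NoConsecutiveMixed d f e → Consecutive d i j → Flat d f e i j
    flat-of-consecutive {i} {j} unmixed consecutive with mixed-or-flat (proj₁ consecutive)
    ... | inj₁ mixed = ⊥-elim (unmixed i j consecutive mixed)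
    ... | inj₂ flat  = flat

    fits-along : ∀ (g : Vecℤ n) {t} → Δ g i j ≡ t →
      SameSide t (F i j) (E i j) → SameSide (Δ g i j) (F i j) (E i j)
    fits-along {i} {j} g G≡t = subst (λ s → SameSide s (F i j) (E i j)) (sym G≡t)

    fits-level : ∀ (g : Vecℤ n) → g i ≡ g j → d i ≤ d j → SameSide (Δ g i j) (F i j) (E i j)
    fits-level {i} {j} g gi≡gj i≤j = fits-along g (Δ-const g gi≡gj) (inj₁ (f-mono i j i≤j , e-mono i j i≤j))

  no-mixed⇒pairwise : (∀ i j → d i ≤ d j → ¬ Mixed f e i j) →
    PairwiseBetween 0ᵛ f e × PairwiseBetween d f e
  no-mixed⇒pairwise none =
    pairwise-along d (λ i j i≤j → proj₁ (bounds i j i≤j)) ,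
    pairwise-along d (λ i j i≤j → proj₂ (bounds i j i≤j))
    where
    bounds : ∀ i j → d i ≤ d j → Between 0ℤ (F i j) (E i j) × Between (D i j) (F i j) (E i j)
    bounds i j i≤j with 0ℤ <? F i j | 0ℤ <? E i j
    ... | yes 0<F | yes 0<E = ⊥-elim (none i j i≤j (0<F , 0<E))
    ... | no 0≮F  | _       =
      between-≤ (≮⇒≥ 0≮F) (e-mono i j i≤j) , between-≤ (F≤D i≤j) (D≤E (≮⇒≥ 0≮F))
    ... | yes _   | no 0≮E  =
      between-≥ (≮⇒≥ 0≮E) (f-mono i j i≤j) , between-≥ (E≤D i≤j) (D≤F (≮⇒≥ 0≮E))

  consecutive-window : ∀ {p q} → Consecutive d p q → Mixed f e p q → Window d f e
  consecutive-window {p} {q} (p<q , nothing-between) (0<F , 0<E) = record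
    { B = d p ; C = d p + 1ℤ ; B<C = B<C ; shape = inj₁ (p , refl , refl) ; fits = fits
    ; cuts = p , q , subst (0ℤ <_) (sym G≡1) (+<+ (s≤s z≤n)) , subst (_< D p q) (sym G≡1) 1<D }
    where
    g : Vecℤ n
    g = clampᵛ (d p) (d p + 1ℤ) d
    B<C : d p < d p + 1ℤ
    B<C = suc[i]≤j⇒i<j (≤-reflexive (+-comm 1ℤ (d p)))
    C≤q : d p + 1ℤ ≤ d q
    C≤q = subst (_≤ d q) (+-comm 1ℤ (d p)) (i<j⇒suc[i]≤j p<q)
    1<D : 1ℤ < D p q
    1<D = subst (1ℤ <_) (sym (D≡F+E p q)) (+-mono-≤-< (i<j⇒suc[i]≤j 0<F) 0<E)
    low-or-high : ∀ k → d k ≤ d p ⊎ d q ≤ d k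
    low-or-high k with d p <? d k
    ... | yes p<k = inj₂ (nothing-between k p<k)
    ... | no p≮k  = inj₁ (≮⇒≥ p≮k)
    g-low : d k ≤ d p → g k ≡ d p
    g-low = clamp-below
    g-high : d q ≤ d k → g k ≡ d p + 1ℤ
    g-high q≤k = clamp-above (<⇒≤ B<C) (≤-trans C≤q q≤k)
    G-across : d i ≤ d p → d q ≤ d j → Δ g i j ≡ 1ℤ
    G-across {i} {j} i≤p q≤j = trans (cong₂ _-_ (g-high q≤j) (g-low i≤p)) (solve (d p))
      where solve : ∀ x → (x + 1ℤ) - x ≡ 1ℤ
            solve = solve-∀
    G≡1 : Δ g p q ≡ 1ℤ
    G≡1 = G-across ≤-refl ≤-refl
    fits : ∀ i j → d i ≤ d j → SameSide (Δ g i j) (F i j) (E i j)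
    fits i j i≤j with low-or-high i | low-or-high j
    ... | inj₁ i≤p | inj₁ j≤p = fits-level g (trans (g-low i≤p) (sym (g-low j≤p))) i≤j
    ... | inj₂ q≤i | inj₂ q≤j = fits-level g (trans (g-high q≤i) (sym (g-high q≤j))) i≤j
    ... | inj₁ i≤p | inj₂ q≤j = fits-along g (G-across i≤p q≤j)
                                  (inj₁ (≤-trans (i<j⇒suc[i]≤j 0<F) (F-inner i≤p (<⇒≤ p<q) q≤j) ,
                                         ≤-trans (i<j⇒suc[i]≤j 0<E) (E-inner i≤p (<⇒≤ p<q) q≤j)))
    ... | inj₂ q≤i | inj₁ j≤p = ⊥-elim (<⇒≱ p<q (≤-trans q≤i (≤-trans i≤j j≤p)))

  module ShortestFlatWindow (unmixed : NoConsecutiveMixed d f e) {b c : Fin n}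
    (shortest : ShortestMaximalFlat d f e b c) (F-flat : F b c ≤ 0ℤ) where

    private
      maximal : MaximalFlat d f e b c
      maximal = proj₁ shortest

      b<c : d b < d c
      b<c = proj₁ (proj₁ maximal)

      F-pos-left : d k < d b → 0ℤ < F k b
      F-pos-left k<b = <-≤-trans (proj₁ (proj₁ (proj₂ maximal) _ k<b)) (Δ-drop-right f F-flat)

      F-pos-right : d c < d k → 0ℤ < F c k
      F-pos-right c<k = <-≤-trans (proj₁ (proj₂ (proj₂ maximal) _ c<k)) (Δ-drop-left f F-flat)

      E-pos-right : d b < d k → 0ℤ < E b k
      E-pos-right {k} b<k with d k ≤? d c
      ... | yes k≤c = <-≤-trans (i<j⇒0<j-i b<k) (D≤E (≤-trans (F-inner ≤-refl (<⇒≤ b<k) k≤c) F-flat))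
      ... | no k≰c  = <-≤-trans (<-≤-trans (i<j⇒0<j-i b<c) (D≤E F-flat))
                                (E-inner ≤-refl (<⇒≤ b<c) (<⇒≤ (≰⇒> k≰c)))

      E-pos-left : d k < d c → 0ℤ < E k c
      E-pos-left {k} k<c with d b ≤? d k
      ... | yes b≤k = <-≤-trans (i<j⇒0<j-i k<c) (D≤E (≤-trans (F-inner b≤k (<⇒≤ k<c) ≤-refl) F-flat))
      ... | no b≰k  = <-≤-trans (<-≤-trans (i<j⇒0<j-i b<c) (D≤E F-flat))
                                (E-inner (<⇒≤ (≰⇒> b≰k)) (<⇒≤ b<c) ≤-refl)

    -- The maximal flat run ending at b is E-flat and, by minimality, at least as long as [b, c].
    left-run-long : d i < d b → 0ℤ < E i b → D b c ≤ F i b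
    left-run-long {i} i<b 0<E = begin
      D b c ≤⟨ proj₂ shortest a b run ⟩
      D a b ≤⟨ D≤F E-flat ⟩
      F a b ≤⟨ F-inner (<⇒≤ i<a) (<⇒≤ a<b) ≤-refl ⟩
      F i b ∎
      where
      open ≤-Reasoning
      leftmost : Σ[ k ∈ Fin n ] Flat d f e k b × (∀ k′ → Flat d f e k′ b → d k ≤ d k′)
      leftmost = minimiser (allFin n) ∈-allFin (λ k → flat? d f e k b) d
                   (flat-of-consecutive unmixed (proj₂ (predecessor {d = d} i<b)))
      a : Fin n
      a = proj₁ leftmost
      flat : Flat d f e a b
      flat = proj₁ (proj₂ leftmost)
      a<b : d a < d b
      a<b = proj₁ flat
      E-flat : E a b ≤ 0ℤ
      E-flat with proj₂ flat
      ... | inj₁ F≤0 = ⊥-elim (<⇒≱ (F-pos-left a<b) F≤0)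
      ... | inj₂ E≤0 = E≤0
      i<a : d i < d a
      i<a = ≰⇒> λ a≤i → <⇒≱ 0<E (≤-trans (E-inner a≤i (<⇒≤ i<b) ≤-refl) E-flat)
      run : MaximalFlat d f e a b
      run = flat , left , right
        where
        left : ∀ k → d k < d a → Mixed f e k b
        left k k<a with mixed-or-flat (<-trans k<a a<b)
        ... | inj₁ mixed = mixed
        ... | inj₂ flat′ = ⊥-elim (<⇒≱ k<a (proj₂ (proj₂ leftmost) k flat′))
        right : ∀ k → d b < d k → Mixed f e a k
        right k b<k =
          <-≤-trans (<-≤-trans (i<j⇒0<j-i a<b) (D≤F E-flat)) (F-inner ≤-refl (<⇒≤ a<b) (<⇒≤ b<k)) ,
          <-≤-trans (E-pos-right b<k) (E-inner (<⇒≤ a<b) (<⇒≤ b<k) ≤-refl)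

    right-run-long : d c < d j → 0ℤ < E c j → D b c ≤ F c j
    right-run-long {j} c<j 0<E = begin
      D b c ≤⟨ proj₂ shortest c a run ⟩
      D c a ≤⟨ D≤F E-flat ⟩
      F c a ≤⟨ F-inner ≤-refl (<⇒≤ c<a) (<⇒≤ a<j) ⟩
      F c j ∎
      where
      open ≤-Reasoning
      rightmost : Σ[ k ∈ Fin n ] Flat d f e c k × (∀ k′ → Flat d f e c k′ → d k′ ≤ d k)
      rightmost = maximiser (allFin n) ∈-allFin (λ k → flat? d f e c k) d
                    (flat-of-consecutive unmixed (proj₂ (successor {d = d} c<j)))
      a : Fin n
      a = proj₁ rightmost
      flat : Flat d f e c a
      flat = proj₁ (proj₂ rightmost)
      c<a : d c < d a
      c<a = proj₁ flat
      E-flat : E c a ≤ 0ℤ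
      E-flat with proj₂ flat
      ... | inj₁ F≤0 = ⊥-elim (<⇒≱ (F-pos-right c<a) F≤0)
      ... | inj₂ E≤0 = E≤0
      a<j : d a < d j
      a<j = ≰⇒> λ j≤a → <⇒≱ 0<E (≤-trans (E-inner ≤-refl (<⇒≤ c<j) j≤a) E-flat)
      run : MaximalFlat d f e c a
      run = flat , left , right
        where
        left : ∀ k → d k < d c → Mixed f e k a
        left k k<c =
          <-≤-trans (<-≤-trans (i<j⇒0<j-i c<a) (D≤F E-flat)) (F-inner (<⇒≤ k<c) (<⇒≤ c<a) ≤-refl) ,
          <-≤-trans (E-pos-left k<c) (E-inner ≤-refl (<⇒≤ k<c) (<⇒≤ c<a))
        right : ∀ k → d a < d k → Mixed f e c k
        right k a<k with mixed-or-flat (<-trans c<a a<k)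
        ... | inj₁ mixed = mixed
        ... | inj₂ flat′ = ⊥-elim (<⇒≱ a<k (proj₂ (proj₂ rightmost) k flat′))

    private
      E-left-flat : d i < d b → F i b < D b c → E i b ≤ 0ℤ
      E-left-flat i<b F<D = ≮⇒≥ λ 0<E → <⇒≱ F<D (left-run-long i<b 0<E)

      E-right-flat : d c < d j → F c j < D b c → E c j ≤ 0ℤ
      E-right-flat c<j F<D = ≮⇒≥ λ 0<E → <⇒≱ F<D (right-run-long c<j 0<E)

      g : Vecℤ n
      g = clampᵛ (d b) (d c) d

      fits-below-inside : d i < d b → d b ≤ d j → d j ≤ d c → SameSide (D b j) (F i j) (E i j)
      fits-below-inside {i} {j} i<b b≤j j≤c = sameSide-crossing
        (≤-trans (D≤E (≤-trans (F-inner ≤-refl b≤j j≤c) F-flat)) (E-inner (<⇒≤ i<b) b≤j ≤-refl))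
        λ F<G → ≤-trans (Δ-drop-left e (E-left-flat i<b (F-small F<G))) (E≤D b≤j)
        where
        F-small : F i j < D b j → F i b < D b c
        F-small F<G = ≤-<-trans (F-inner ≤-refl (<⇒≤ i<b) b≤j) (<-≤-trans F<G (D-inner ≤-refl b≤j j≤c))

      fits-inside-above : d b ≤ d i → d i ≤ d c → d c < d j → SameSide (D i c) (F i j) (E i j)
      fits-inside-above {i} {j} b≤i i≤c c<j = sameSide-crossing
        (≤-trans (D≤E (≤-trans (F-inner b≤i i≤c ≤-refl) F-flat)) (E-inner ≤-refl i≤c (<⇒≤ c<j)))
        λ F<G → ≤-trans (Δ-drop-right e (E-right-flat c<j (F-small F<G))) (E≤D i≤c)
        where
        F-small : F i j < D i c → F c j < D b c
        F-small F<G = ≤-<-trans (F-inner i≤c (<⇒≤ c<j) ≤-refl) (<-≤-trans F<G (D-inner b≤i i≤c ≤-refl))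

      fits-below-above : d i < d b → d c < d j → SameSide (D b c) (F i j) (E i j)
      fits-below-above {i} {j} i<b c<j = sameSide-crossing
        (≤-trans (D≤E F-flat) (E-inner (<⇒≤ i<b) (<⇒≤ b<c) (<⇒≤ c<j)))
        λ F<G → begin
          E i j ≤⟨ Δ-drop-left e (E-left-flat i<b (≤-<-trans (F-inner ≤-refl (<⇒≤ i<b) (<⇒≤ b<j)) F<G)) ⟩
          E b j ≤⟨ Δ-drop-right e (E-right-flat c<j (≤-<-trans (F-inner (<⇒≤ i<c) (<⇒≤ c<j) ≤-refl) F<G)) ⟩
          E b c ≤⟨ E≤D (<⇒≤ b<c) ⟩
          D b c ∎
        where
        open ≤-Reasoning
        b<j : d b < d j
        b<j = <-trans b<c c<j
        i<c : d i < d c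
        i<c = <-trans i<b b<c

      g-below : d k < d b → g k ≡ d b
      g-below k<b = clamp-below (<⇒≤ k<b)

      g-inside : d b ≤ d k → d k ≤ d c → g k ≡ d k
      g-inside = clamp-inside

      g-above : d c < d k → g k ≡ d c
      g-above c<k = clamp-above (<⇒≤ b<c) (<⇒≤ c<k)

      at : g i ≡ d k → g j ≡ d l → SameSide (D k l) (F i j) (E i j) → SameSide (Δ g i j) (F i j) (E i j)
      at gi gj = fits-along g (cong₂ _-_ gj gi)

    fits : ∀ i j → d i ≤ d j → SameSide (Δ g i j) (F i j) (E i j)
    fits i j i≤j with position (d b) (d c) (d i) | position (d b) (d c) (d j)
    ... | below i<b      | below j<b      = fits-level g (trans (g-below i<b) (sym (g-below j<b))) i≤j
    ... | below i<b      | inside b≤j j≤c = at (g-below i<b) (g-inside b≤j j≤c) (fits-below-inside i<b b≤j j≤c)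
    ... | below i<b      | above c<j      = at (g-below i<b) (g-above c<j) (fits-below-above i<b c<j)
    ... | inside b≤i i≤c | inside b≤j j≤c = at (g-inside b≤i i≤c) (g-inside b≤j j≤c) (inj₂ (F≤D i≤j , E≤D i≤j))
    ... | inside b≤i i≤c | above c<j      = at (g-inside b≤i i≤c) (g-above c<j) (fits-inside-above b≤i i≤c c<j)
    ... | above c<i      | above c<j      = fits-level g (trans (g-above c<i) (sym (g-above c<j))) i≤j
    ... | inside b≤i _   | below j<b      = ⊥-elim (<⇒≱ j<b (≤-trans b≤i i≤j))
    ... | above c<i      | below j<b      = ⊥-elim (<⇒≱ (<-trans j<b (<-trans b<c c<i)) i≤j)
    ... | above c<i      | inside _ j≤c   = ⊥-elim (<⇒≱ (≤-<-trans j≤c c<i) i≤j)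

    cuts : ∀ {p q} → d p ≤ d q → Mixed f e p q → StrictCut (d b) (d c) d
    cuts {p} {q} p≤q (0<F , _) with d p <? d b | d c <? d q
    ... | yes p<b | _       = strictCut-left {d = d} p<b b<c
    ... | no _    | yes c<q = strictCut-right {d = d} b<c c<q
    ... | no p≮b  | no c≮q  = ⊥-elim (<⇒≱ 0<F (≤-trans (F-inner (≮⇒≥ p≮b) p≤q (≮⇒≥ c≮q)) F-flat))

    window : ∀ {p q} → d p ≤ d q → Mixed f e p q → Window d f e
    window p≤q mixed = record
      { B = d b ; C = d c ; B<C = b<c ; shape = inj₂ (b , c , refl , refl)
      ; fits = fits ; cuts = cuts p≤q mixed }

  longest-flat-maximal : ∀ {b c} → Flat d f e b c →
    (∀ b′ c′ → Flat d f e b′ c′ → D b′ c′ ≤ D b c) → MaximalFlat d f e b c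
  longest-flat-maximal {b} {c} flat longest = flat , left , right
    where
    left : ∀ k → d k < d b → Mixed f e k c
    left k k<b with mixed-or-flat (<-trans k<b (proj₁ flat))
    ... | inj₁ mixed = mixed
    ... | inj₂ flat′ = ⊥-elim (<⇒≱ (Δ-<-left d k<b) (longest k c flat′))
    right : ∀ k → d c < d k → Mixed f e b k
    right k c<k with mixed-or-flat (<-trans (proj₁ flat) c<k)
    ... | inj₁ mixed = mixed
    ... | inj₂ flat′ = ⊥-elim (<⇒≱ (Δ-<-right d c<k) (longest b k flat′))

  shortest-maximalFlat : NoConsecutiveMixed d f e → ∀ {p q} → d p ≤ d q → Mixed f e p q →
    ∃[ b ] ∃[ c ] ShortestMaximalFlat d f e b c
  shortest-maximalFlat unmixed {p} {q} p≤q (0<F , 0<E)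
    with maximiser (allPairs n) ∈-allPairs (uncurry (flat? d f e)) (uncurry D) start
    where
    p<q : d p < d q
    p<q = 0<j-i⇒i<j (subst (0ℤ <_) (sym (D≡F+E p q)) (+-mono-< 0<F 0<E))
    start : Flat d f e p (proj₁ (successor {d = d} p<q))
    start = flat-of-consecutive unmixed (proj₂ (successor {d = d} p<q))
  ... | (b₀ , c₀) , flat , longest
    with minimiser (allPairs n) ∈-allPairs (uncurry (maximalFlat? d f e)) (uncurry D)
           (longest-flat-maximal flat λ b′ c′ → longest (b′ , c′))
  ... | (b , c) , maximal , least = b , c , maximal , λ b′ c′ → least (b′ , c′)

consecutive-mixed-or-none : (d f e : Vecℤ n) →
  (∃[ p ] ∃[ q ] Consecutive d p q × Mixed f e p q) ⊎ NoConsecutiveMixed d f e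
consecutive-mixed-or-none d f e with any? (λ p → any? (λ q → consecutive? d p q ×-dec mixed? f e p q))
... | yes found = inj₁ found
... | no none   = inj₂ λ p q consecutive mixed → none (p , q , consecutive , mixed)

window : ∀ {d f e : Vecℤ n} {p q} → MonotoneSum d f e → d p ≤ d q → Mixed f e p q → Window d f e
window {d = d} {f} {e} split p≤q mixed with consecutive-mixed-or-none d f e
... | inj₁ (_ , _ , consecutive , mixed′) = consecutive-window split consecutive mixed′
... | inj₂ unmixed with shortest-maximalFlat split unmixed p≤q mixed
...   | _ , _ , shortest with proj₂ (proj₁ (proj₁ shortest))
...     | inj₁ F-flat = ShortestFlatWindow.window split unmixed shortest F-flat p≤q mixed
...     | inj₂ E-flat = window-swap (ShortestFlatWindow.window (monotoneSum-swap split)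
                          (λ p q consecutive mixed → unmixed p q consecutive (Product.swap mixed))
                          (shortest-swap {f = f} {e} shortest) E-flat p≤q (Product.swap mixed))

module Translated {n} (π l m l'' m'' : Vecℤ n) (inS : InS π (l , m)) (inS'' : InS π (l'' , m'')) where

  d f e : Vecℤ n
  d = m -ᵛ l
  f = l'' -ᵛ l
  e = m'' -ᵛ l

  l≗ : l ≗ l ⊕ 0ᵛ
  l≗ = ⊕-identityʳ

  m≗ : m ≗ l ⊕ d
  m≗ = ⊕-difference

  l''≗ : l'' ≗ l ⊕ f
  l''≗ = ⊕-difference

  m''≗ : m'' ≗ l ⊕ e
  m''≗ = ⊕-difference

  d≗f⊕e : d ≗ f ⊕ e
  d≗f⊕e = pointwise λ i → begin
    m i - l i                         ≡⟨ solve (l i) (m i) ⟩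
    (l i + m i) - l i - l i           ≡⟨ cong (λ s → s - l i - l i) (trans (inS i) (sym (inS'' i))) ⟩
    (l'' i + m'' i) - l i - l i       ≡⟨ solve′ (l i) (l'' i) (m'' i) ⟩
    (l'' i - l i) + (m'' i - l i)     ∎
    where
    open ≡-Reasoning
    solve : ∀ a b → b - a ≡ (a + b) - a - a
    solve = solve-∀
    solve′ : ∀ a x y → (x + y) - a - a ≡ (x - a) + (y - a)
    solve′ = solve-∀

  ⊑⇒monotoneSum : (l'' , m'') ⊑ (l , m) → MonotoneSum d f e
  ⊑⇒monotoneSum l''⊑ = pairwise⇒monotoneSum d≗f⊕e
    (pairwise-untranslate l''≗ l≗ m≗ (∈Π⇒pairwise (l''⊑ l'' (∈Π-left {x = l''} {y = m''}))))

  mixed-pair-or-⊒ : MonotoneSum d f e → (∃[ p ] ∃[ q ] d p ≤ d q × Mixed f e p q) ⊎ (l , m) ⊑ (l'' , m'')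
  mixed-pair-or-⊒ split with any? (λ p → any? (λ q → (d p ≤? d q) ×-dec mixed? f e p q))
  ... | yes found = inj₁ found
  ... | no none   = inj₂ (⊑-translate l≗ m≗ l''≗ m''≗
                            (proj₁ no-mixed) (proj₂ no-mixed))
    where
    no-mixed : PairwiseBetween 0ᵛ f e × PairwiseBetween d f e
    no-mixed = no-mixed⇒pairwise split λ p q p≤q mixed → none (p , q , p≤q , mixed)

mainTheorem14 : (n : ℕ) (π l m l'' m'' : Vecℤ n) →
    InS π (l , m) → InS π (l'' , m'') →
    (l'' , m'') ⊏ (l , m) →
    ∃[ b ] ∃[ c ] (b < c) ×
      (((∃[ p ] (b ≡ (m -ᵛ l) p × c ≡ (m -ᵛ l) p + 1ℤ))
        ⊎ (∃[ p ] ∃[ q ] (b ≡ (m -ᵛ l) p × c ≡ (m -ᵛ l) q)))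
      × (((zig b c l m , zag b c l m) ⊏ (l , m))
        × ((l'' , m'') ⊑ (zig b c l m , zag b c l m))))
mainTheorem14 n π l m l'' m'' inS inS'' (l''⊑l , l⋢l'') =
  case mixed-pair-or-⊒ split of λ where
    (inj₂ l⊑l'') → ⊥-elim (l⋢l'' (l⊑l'' , l''⊑l))
    (inj₁ (p , q , p≤q , mixed)) →
      let open Window (window split p≤q mixed)
          open ZigZag l m (<⇒≤ B<C) using (zigzag-⊑; ¬⊑-zigzag; ⊑-zigzag)
      in B , C , B<C , shape , (zigzag-⊑ , λ (l⊑ , _) → ¬⊑-zigzag cuts l⊑) ,
         ⊑-zigzag l''≗ m''≗ d≗f⊕e fits
  where
  open Translated π l m l'' m'' inS inS''
  split : MonotoneSum d f e
  split = ⊑⇒monotoneSum l''⊑l
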